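{- $RST_{HF}^m\vdash\forall x\in HF\,\forall y\,(y\in x\rightarrow x\notin y)$.
   Context: The language $\mathcal{L}_{RST}^{\{HF\}}$ is first-order with binary relations $\in,=$, one constant $HF$, connectives $\neg,\wedge,\vee$, the quantifier $\exists$ ($\forall$ and $\to$ are classical abbreviations), and set-abstraction terms. Terms, formulas and the safety relation $\varphi\succ\Theta$ ($\Theta$ a finite set of variables) are defined simultaneously: terms are the variables, $HF$, and $\{x\mid\varphi\}$ whenever $\varphi\succ\{x\}$; atomic formulas are $t=s$, $t\in s$; formulas are closed under $\neg,\wedge,\vee,\exists x$. Safety rules: every atomic formula is $\succ\emptyset$; if $x\notin Fv(t)$, each of $x\neq x$, $x\in t$, $x=t$, $t=x$ is $\succ\{x\}$; if $\varphi\succ\emptyset$ then $\neg\varphi\succ\emptyset$; if $\varphi\succ\Theta$ and $\psi\succ\Theta$ then $\varphi\vee\psi\succ\Theta$; if $\varphi\succ\Theta$, $\psi\succ\Phi$ and ($\Phi\cap Fv(\varphi)=\emptyset$ or $\Theta\cap Fv(\psi)=\emptyset$) then $\varphi\wedge\psi\succ\Theta\cup\Phi$; if $\varphi\succ\Theta$ and $y\in\Theta$ then $\exists y\varphi\succ\Theta\setminus\{y\}$. $RST_{HF}^m$ is the classical first-order theory (with variable-binding term operator) in this language with axioms: Extensionality $\forall z(z\in x\leftrightarrow z\in y)\to x=y$; Comprehension $\forall x(x\in\{x\mid\varphi\}\leftrightarrow\varphi)$ for every legal term $\{x\mid\varphi\}$; $\emptyset\in HF$; $\forall x\forall y(x\in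 HF\wedge y\in HF\to x\cup\{y\}\in HF)$; $\forall y(\emptyset\in y\wedge\forall v,w\in y.\,v\cup\{w\}\in y\to HF\subseteq y)$, with $\emptyset=\{x\mid x\neq x\}$, $\{y\}=\{x\mid x=y\}$, $a\cup b=\{x\mid x\in a\vee x\in b\}$, and $\subseteq$ defined from $\in$ as usual. Note that the theory contains no $\in$-induction or foundation axiom. -}

module Defs where

open import Data.Nat using (ℕ; _≟_)
open import Data.Bool using (Bool; true; false; not; _∧_; _∨_; if_then_else_)
open import Data.List using (List; []; _∷_; _++_; filter)
open import Data.List.Membership.Propositional using (_∈_; _∉_)
open import Data.Product using (_×_)
open import Data.Sum using (_⊎_)
open import Data.Unit using (⊤)
open import Data.Empty using (⊥)
open import Function.Bundles using (_⇔_)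
open import Relation.Nullary using (¬_)
open import Relation.Nullary.Decidable using (¬?; ⌊_⌋)
open import Relation.Binary.PropositionalEquality using (_≡_)

Var : Set
Var = ℕ

mutual
  data Term : Set where
    var : Var → Term
    HF  : Term
    abs : Var → Formula → Term          -- { x | φ }

  data Formula : Set where
    eq  : Term → Term → Formula
    mem : Term → Term → Formula
    neg : Formula → Formula
    and : Formula → Formula → Formula
    or  : Formula → Formula → Formula
    ex  : Var → Formula → Formula

remove : Var → List Var → List Var
remove y xs = filter (λ w → ¬? (w ≟ y)) xs

mutual
  FvT : Term → List Var
  FvT (var x)   = x ∷ []
  FvT HF        = []
  FvT (abs x φ) = remove x (FvF φ)

  FvF : Formula → List Var
  FvF (eq t s)  = FvT t ++ FvT s
  FvF (mem t s) = FvT t ++ FvT s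
  FvF (neg φ)   = FvF φ
  FvF (and φ ψ) = FvF φ ++ FvF ψ
  FvF (or φ ψ)  = FvF φ ++ FvF ψ
  FvF (ex x φ)  = remove x (FvF φ)

Disjoint : List Var → List Var → Set
Disjoint A B = ∀ z → z ∈ A → z ∈ B → ⊥

-- Legal terms, legal formulas and the safety relation  φ ≻ Θ
-- (finite sets of variables are represented by lists, considered up to
--  having the same elements: rule safe-≈)

mutual
  data WfT : Term → Set where
    wf-var : ∀ x → WfT (var x)
    wf-HF  : WfT HF
    wf-abs : ∀ {x φ} → Safe φ (x ∷ []) → WfT (abs x φ)

  data WfF : Formula → Set where
    wf-eq  : ∀ {t s} → WfT t → WfT s → WfF (eq t s)
    wf-mem : ∀ {t s} → WfT t → WfT s → WfF (mem t s)
    wf-neg : ∀ {φ} → WfF φ → WfF (neg φ)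
    wf-and : ∀ {φ ψ} → WfF φ → WfF ψ → WfF (and φ ψ)
    wf-or  : ∀ {φ ψ} → WfF φ → WfF ψ → WfF (or φ ψ)
    wf-ex  : ∀ {x φ} → WfF φ → WfF (ex x φ)

  data Safe : Formula → List Var → Set where
    safe-eq   : ∀ {t s} → WfT t → WfT s → Safe (eq t s) []
    safe-mem  : ∀ {t s} → WfT t → WfT s → Safe (mem t s) []
    safe-neq  : ∀ x → Safe (neg (eq (var x) (var x))) (x ∷ [])
    safe-memx : ∀ {x t} → WfT t → x ∉ FvT t → Safe (mem (var x) t) (x ∷ [])
    safe-eqxl : ∀ {x t} → WfT t → x ∉ FvT t → Safe (eq (var x) t) (x ∷ [])
    safe-eqxr : ∀ {x t} → WfT t → x ∉ FvT t → Safe (eq t (var x)) (x ∷ [])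
    safe-neg  : ∀ {φ} → Safe φ [] → Safe (neg φ) []
    safe-or   : ∀ {φ ψ Θ} → Safe φ Θ → Safe ψ Θ → Safe (or φ ψ) Θ
    safe-and  : ∀ {φ ψ Θ Φ} → Safe φ Θ → Safe ψ Φ →
                (Disjoint Φ (FvF φ) ⊎ Disjoint Θ (FvF ψ)) →
                Safe (and φ ψ) (Θ ++ Φ)
    safe-ex   : ∀ {φ Θ y} → Safe φ Θ → y ∈ Θ → Safe (ex y φ) (remove y Θ)
    safe-≈    : ∀ {φ Θ Θ'} → Safe φ Θ → (∀ z → (z ∈ Θ) ⇔ (z ∈ Θ')) → Safe φ Θ'

_⇒_ : Formula → Formula → Formula
φ ⇒ ψ = or (neg φ) ψ
infixr 4 _⇒_

_⇔̇_ : Formula → Formula → Formula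
φ ⇔̇ ψ = and (φ ⇒ ψ) (ψ ⇒ φ)

all : Var → Formula → Formula
all x φ = neg (ex x (neg φ))

-- Naive substitution  φ[u/z]  together with "u is free for z in φ"

_==_ : Var → Var → Bool
x == y = ⌊ x ≟ y ⌋

mutual
  substT : Term → Var → Term → Term
  substT u z (var y)   = if y == z then u else var y
  substT u z HF        = HF
  substT u z (abs y φ) = if y == z then abs y φ else abs y (substF u z φ)

  substF : Term → Var → Formula → Formula
  substF u z (eq t s)  = eq (substT u z t) (substT u z s)
  substF u z (mem t s) = mem (substT u z t) (substT u z s)
  substF u z (neg φ)   = neg (substF u z φ)
  substF u z (and φ ψ) = and (substF u z φ) (substF u z ψ)
  substF u z (or φ ψ)  = or (substF u z φ) (substF u z ψ)
  substF u z (ex y φ)  = if y == z then ex y φ else ex y (substF u z φ)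

mutual
  FreeForT : Term → Var → Term → Set
  FreeForT u z (var y)   = ⊤
  FreeForT u z HF        = ⊤
  FreeForT u z (abs y φ) = (z ∉ FvT (abs y φ)) ⊎ ((y ∉ FvT u) × FreeForF u z φ)

  FreeForF : Term → Var → Formula → Set
  FreeForF u z (eq t s)  = FreeForT u z t × FreeForT u z s
  FreeForF u z (mem t s) = FreeForT u z t × FreeForT u z s
  FreeForF u z (neg φ)   = FreeForF u z φ
  FreeForF u z (and φ ψ) = FreeForF u z φ × FreeForF u z ψ
  FreeForF u z (or φ ψ)  = FreeForF u z φ × FreeForF u z ψ
  FreeForF u z (ex y φ)  = (z ∉ FvF (ex y φ)) ⊎ ((y ∉ FvT u) × FreeForF u z φ)

eval : (Formula → Bool) → Formula → Bool
eval v (eq t s)  = v (eq t s)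
eval v (mem t s) = v (mem t s)
eval v (neg φ)   = not (eval v φ)
eval v (and φ ψ) = eval v φ ∧ eval v ψ
eval v (or φ ψ)  = eval v φ ∨ eval v ψ
eval v (ex x φ)  = v (ex x φ)

Tautology : Formula → Set
Tautology φ = ∀ (v : Formula → Bool) → eval v φ ≡ true

data _⊢_ (T : Formula → Set) : Formula → Set where
  nonlogical : ∀ {φ} → WfF φ → T φ → T ⊢ φ
  tautology  : ∀ {φ} → WfF φ → Tautology φ → T ⊢ φ
  subst-ax   : ∀ {t x φ} → WfF (substF t x φ ⇒ ex x φ) → FreeForF t x φ →
               T ⊢ (substF t x φ ⇒ ex x φ)
  refl-ax    : ∀ {t} → WfT t → T ⊢ eq t t
  eq-ax      : ∀ {t s z φ} →
               WfF (eq t s ⇒ (substF t z φ ⇒ substF s z φ)) →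
               FreeForF t z φ → FreeForF s z φ →
               T ⊢ (eq t s ⇒ (substF t z φ ⇒ substF s z φ))
  mp         : ∀ {φ ψ} → T ⊢ φ → T ⊢ (φ ⇒ ψ) → T ⊢ ψ
  ∃-intro    : ∀ {x φ ψ} → T ⊢ (φ ⇒ ψ) → x ∉ FvF ψ → T ⊢ (ex x φ ⇒ ψ)

-- Defined terms (k = the bound variable, chosen fresh at each use)

emptyT : Var → Term
emptyT k = abs k (neg (eq (var k) (var k)))

singT : Var → Term → Term
singT k a = abs k (eq (var k) a)

unionT : Var → Term → Term → Term
unionT k a b = abs k (or (mem (var k) a) (mem (var k) b))

data RST-HF : Formula → Set where
  -- Extensionality: ∀z(z∈x ↔ z∈y) → x = y   (x = 0, y = 1, z = 2)
  extensionality :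
    RST-HF (all 2 (mem (var 2) (var 0) ⇔̇ mem (var 2) (var 1)) ⇒ eq (var 0) (var 1))
  comprehension : ∀ {x φ} → WfT (abs x φ) →
    RST-HF (all x (mem (var x) (abs x φ) ⇔̇ φ))
  hf-empty : RST-HF (mem (emptyT 0) HF)
  -- ∀x∀y(x ∈ HF ∧ y ∈ HF → x ∪ {y} ∈ HF)   (x = 0, y = 1)
  hf-step :
    RST-HF (all 0 (all 1 (and (mem (var 0) HF) (mem (var 1) HF) ⇒
                            mem (unionT 3 (var 0) (singT 2 (var 1))) HF)))
  -- ∀y(∅ ∈ y ∧ ∀v,w ∈ y. v ∪ {w} ∈ y → HF ⊆ y)   (y = 0, v = 1, w = 2, z = 3)
  hf-least :
    RST-HF (all 0 (and (mem (emptyT 4) (var 0))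
                       (all 1 (mem (var 1) (var 0) ⇒
                         all 2 (mem (var 2) (var 0) ⇒
                           mem (unionT 6 (var 1) (singT 5 (var 2))) (var 0))))
                   ⇒ all 3 (mem (var 3) HF ⇒ mem (var 3) (var 0))))

hf-no-2-cycles : Formula
hf-no-2-cycles =
  all 0 (mem (var 0) HF ⇒ all 1 (mem (var 1) (var 0) ⇒ neg (mem (var 0) (var 1))))

module Submission where

-- HF-induction (hf-least) is applied to loopFreeHF = {x | x ∈ HF ∧ loopFree x}, where
-- loopFree x says that no w ∈ u ∈ x includes x; taking w = x, loopFree x gives
-- y ∈ x → x ∉ y. Unlike that conclusion, loopFree passes from x and y to x ∪ {y}: a
-- witness u ∈ x ∪ {y}, w ∈ u with x ∪ {y} ⊆ w either has u ∈ x, and then x ⊆ w contradicts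
-- loopFree x, or u = y, and then y ∈ x ∪ {y} ⊆ w ∈ y is a 2-cycle excluded by loopFree y.

open import Defs
open import Data.Nat using (ℕ; zero; suc; _≟_; _<?_)
open import Data.Bool using (Bool; true; false; not; _∧_; _∨_; T)
open import Data.Bool.Properties using (T-∧)
open import Data.Fin using (Fin; fromℕ<)
open import Data.Vec using (Vec; []; _∷_; lookup; map)
open import Data.Vec.Properties using (lookup-map)
open import Data.Vec.Relation.Unary.All as Allᵛ using ([]; _∷_)
open import Data.Vec.Relation.Unary.All.Properties using (lookup⁺)
open import Data.List using (List; []; _∷_)
open import Data.List.Relation.Unary.All using (All; []; _∷_)
open import Data.List.Relation.Unary.Any using (here)
open import Data.List.Membership.Propositional using (_∉_)
open import Data.List.Membership.Propositional.Properties using (∈-filter⁻)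
open import Data.List.Membership.DecPropositional _≟_ using (_∉?_)
open import Data.List.Properties using (filter-reject)
open import Data.Maybe using (Maybe; just; nothing; is-just; to-witness-T)
import Data.Maybe as Maybe
open import Data.Product using (_×_; _,_; proj₁; proj₂)
open import Data.Sum using (inj₁)
open import Data.Unit using (tt)
open import Function using (_∘_)
open import Function.Bundles using (Equivalence)
open import Relation.Nullary using (yes; ¬?)
open import Relation.Nullary.Decidable using (Dec; True; toWitness; _⊎-dec_; _×-dec_)
open import Relation.Binary.PropositionalEquality using (_≡_; refl; sym; trans; cong; cong₂; subst)

⊢-wf : ∀ {𝒯 φ} → 𝒯 ⊢ φ → WfF φ
⊢-wf (nonlogical w _) = w
⊢-wf (tautology w _)  = w
⊢-wf (subst-ax w _)   = w
⊢-wf (refl-ax w)      = wf-eq w w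
⊢-wf (eq-ax w _ _)    = w
⊢-wf (mp _ d) with ⊢-wf d
... | wf-or _ wψ = wψ
⊢-wf (∃-intro d _) with ⊢-wf d
... | wf-or (wf-neg wφ) wψ = wf-or (wf-neg (wf-ex wφ)) wψ

wf-⇒⁻ : ∀ {φ ψ} → WfF (φ ⇒ ψ) → WfF φ × WfF ψ
wf-⇒⁻ (wf-or (wf-neg wφ) wψ) = wφ , wψ

wf-neg⁻ : ∀ {φ} → WfF (neg φ) → WfF φ
wf-neg⁻ (wf-neg wφ) = wφ

∉-remove : ∀ x xs → x ∉ remove x xs
∉-remove x xs x∈ = proj₂ (∈-filter⁻ (λ w → ¬? (w ≟ x)) {xs = xs} x∈) refl

remove-self : ∀ x → remove x (x ∷ []) ≡ []
remove-self x = filter-reject (λ w → ¬? (w ≟ x)) (λ x≢x → x≢x refl)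

mutual
  freeForT? : ∀ u z t → Dec (FreeForT u z t)
  freeForT? u z (var y)   = yes tt
  freeForT? u z HF        = yes tt
  freeForT? u z (abs y φ) = z ∉? FvT (abs y φ) ⊎-dec y ∉? FvT u ×-dec freeForF? u z φ

  freeForF? : ∀ u z φ → Dec (FreeForF u z φ)
  freeForF? u z (eq t s)  = freeForT? u z t ×-dec freeForT? u z s
  freeForF? u z (mem t s) = freeForT? u z t ×-dec freeForT? u z s
  freeForF? u z (neg φ)   = freeForF? u z φ
  freeForF? u z (and φ ψ) = freeForF? u z φ ×-dec freeForF? u z ψ
  freeForF? u z (or φ ψ)  = freeForF? u z φ ×-dec freeForF? u z ψ
  freeForF? u z (ex y φ)  = z ∉? FvF (ex y φ) ⊎-dec y ∉? FvT u ×-dec freeForF? u z φ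

-- Partial: safety is recognised only in the syntax-directed shapes occurring below.
mutual
  wfT? : ∀ t → Maybe (WfT t)
  wfT? (var x)   = just (wf-var x)
  wfT? HF        = just wf-HF
  wfT? (abs x φ) = Maybe.map wf-abs (safe₁? x φ)

  wfF? : ∀ φ → Maybe (WfF φ)
  wfF? (eq t s)  = Maybe.zipWith wf-eq (wfT? t) (wfT? s)
  wfF? (mem t s) = Maybe.zipWith wf-mem (wfT? t) (wfT? s)
  wfF? (neg φ)   = Maybe.map wf-neg (wfF? φ)
  wfF? (and φ ψ) = Maybe.zipWith wf-and (wfF? φ) (wfF? ψ)
  wfF? (or φ ψ)  = Maybe.zipWith wf-or (wfF? φ) (wfF? ψ)
  wfF? (ex x φ)  = Maybe.map wf-ex (wfF? φ)

  safe₁? : ∀ y φ → Maybe (Safe φ (y ∷ []))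
  safe₁? y (neg (eq (var a) (var b))) with a ≟ y | b ≟ y
  ... | yes refl | yes refl = just (safe-neq a)
  ... | _        | _        = nothing
  safe₁? y (mem (var a) t) with a ≟ y | a ∉? FvT t
  ... | yes refl | yes y∉t = Maybe.map (λ wt → safe-memx wt y∉t) (wfT? t)
  ... | _        | _       = nothing
  safe₁? y (eq (var a) t) with a ≟ y | a ∉? FvT t
  ... | yes refl | yes y∉t = Maybe.map (λ wt → safe-eqxl wt y∉t) (wfT? t)
  ... | _        | _       = nothing
  safe₁? y (or φ ψ)  = Maybe.zipWith safe-or (safe₁? y φ) (safe₁? y ψ)
  safe₁? y (and φ ψ) = Maybe.zipWith (λ sφ sψ → safe-and sφ sψ (inj₁ λ _ ())) (safe₁? y φ) (safe₀? ψ)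
  safe₁? y _         = nothing

  safe₀? : ∀ φ → Maybe (Safe φ [])
  safe₀? (eq t s)  = Maybe.zipWith safe-eq (wfT? t) (wfT? s)
  safe₀? (mem t s) = Maybe.zipWith safe-mem (wfT? t) (wfT? s)
  safe₀? (neg φ)   = Maybe.map safe-neg (safe₀? φ)
  safe₀? (and φ ψ) = Maybe.zipWith (λ sφ sψ → safe-and sφ sψ (inj₁ λ _ ())) (safe₀? φ) (safe₀? ψ)
  safe₀? (or φ ψ)  = Maybe.zipWith safe-or (safe₀? φ) (safe₀? ψ)
  safe₀? (ex y φ)  =
    Maybe.map (λ s → subst (Safe (ex y φ)) (remove-self y) (safe-ex s (here refl))) (safe₁? y φ)

fresh : ∀ {xs} x → {x∉xs : True (x ∉? xs)} → x ∉ xs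
fresh x {x∉xs} = toWitness x∉xs

WfChecked : Formula → Set
WfChecked φ = T (is-just (wfF? φ))

wf! : ∀ φ → WfChecked φ → WfF φ
wf! φ = to-witness-T (wfF? φ)

data Schema (n : ℕ) : Set where
  at   : Fin n → Schema n
  ¬'_  : Schema n → Schema n
  _∧'_ : Schema n → Schema n → Schema n
  _∨'_ : Schema n → Schema n → Schema n

infix  11 ¬'_
infixr 10 _∧'_
infixr 9  _∨'_
infixr 8  _⇒'_
infix  7  _⇔'_

_⇒'_ : ∀ {n} → Schema n → Schema n → Schema n
p ⇒' q = ¬' p ∨' q

_⇔'_ : ∀ {n} → Schema n → Schema n → Schema n
p ⇔' q = (p ⇒' q) ∧' (q ⇒' p)

infix 12 #_
#_ : ∀ {n} m {m<n : True (m <? n)} → Schema n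
#_ m {m<n} = at (fromℕ< (toWitness m<n))

⟦_⟧ : ∀ {n} → Schema n → Vec Formula n → Formula
⟦ at i   ⟧ σ = lookup σ i
⟦ ¬' p   ⟧ σ = neg (⟦ p ⟧ σ)
⟦ p ∧' q ⟧ σ = and (⟦ p ⟧ σ) (⟦ q ⟧ σ)
⟦ p ∨' q ⟧ σ = or (⟦ p ⟧ σ) (⟦ q ⟧ σ)

⟦_⟧ᵇ : ∀ {n} → Schema n → Vec Bool n → Bool
⟦ at i   ⟧ᵇ bs = lookup bs i
⟦ ¬' p   ⟧ᵇ bs = not (⟦ p ⟧ᵇ bs)
⟦ p ∧' q ⟧ᵇ bs = ⟦ p ⟧ᵇ bs ∧ ⟦ q ⟧ᵇ bs
⟦ p ∨' q ⟧ᵇ bs = ⟦ p ⟧ᵇ bs ∨ ⟦ q ⟧ᵇ bs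

eval-⟦⟧ : ∀ {n} v (σ : Vec Formula n) p → eval v (⟦ p ⟧ σ) ≡ ⟦ p ⟧ᵇ (map (eval v) σ)
eval-⟦⟧ v σ (at i)   = sym (lookup-map i (eval v) σ)
eval-⟦⟧ v σ (¬' p)   = cong not (eval-⟦⟧ v σ p)
eval-⟦⟧ v σ (p ∧' q) = cong₂ _∧_ (eval-⟦⟧ v σ p) (eval-⟦⟧ v σ q)
eval-⟦⟧ v σ (p ∨' q) = cong₂ _∨_ (eval-⟦⟧ v σ p) (eval-⟦⟧ v σ q)

wf-⟦⟧ : ∀ {n} {σ : Vec Formula n} → Allᵛ.All WfF σ → ∀ p → WfF (⟦ p ⟧ σ)
wf-⟦⟧ wσ (at i)   = lookup⁺ wσ i
wf-⟦⟧ wσ (¬' p)   = wf-neg (wf-⟦⟧ wσ p)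
wf-⟦⟧ wσ (p ∧' q) = wf-and (wf-⟦⟧ wσ p) (wf-⟦⟧ wσ q)
wf-⟦⟧ wσ (p ∨' q) = wf-or (wf-⟦⟧ wσ p) (wf-⟦⟧ wσ q)

allAssignments : ∀ n → (Vec Bool n → Bool) → Bool
allAssignments zero    f = f []
allAssignments (suc n) f = allAssignments n (f ∘ (true ∷_)) ∧ allAssignments n (f ∘ (false ∷_))

allAssignments-sound : ∀ n f → T (allAssignments n f) → ∀ bs → f bs ≡ true
allAssignments-sound zero f h [] with f []
... | true = refl
allAssignments-sound (suc n) f h (b ∷ bs)
  with Equivalence.to (T-∧ {allAssignments n (f ∘ (true ∷_))}) h
allAssignments-sound (suc n) f h (true ∷ bs)  | ht , _  = allAssignments-sound n _ ht bs
allAssignments-sound (suc n) f h (false ∷ bs) | _  , hf = allAssignments-sound n _ hf bs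

Valid : ∀ {n} → Schema n → Set
Valid {n} p = T (allAssignments n ⟦ p ⟧ᵇ)

_⟹_ : ∀ {n} → List (Schema n) → Schema n → Schema n
[]       ⟹ q = q
(p ∷ ps) ⟹ q = p ⇒' (ps ⟹ q)

allWf? : ∀ {n} (σ : Vec Formula n) → Maybe (Allᵛ.All WfF σ)
allWf? []      = just []
allWf? (φ ∷ σ) = Maybe.zipWith _∷_ (wfF? φ) (allWf? σ)

module DerivedRules (𝒯 : Formula → Set) where

  ⊢_ : Formula → Set
  ⊢ φ = 𝒯 ⊢ φ
  infix 2 ⊢_

  tautology-instance : ∀ {n} {σ : Vec Formula n} → Allᵛ.All WfF σ → ∀ p → Valid p → ⊢ ⟦ p ⟧ σ
  tautology-instance {n} {σ} wσ p valid =
    tautology (wf-⟦⟧ wσ p) λ v →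
      trans (eval-⟦⟧ v σ p) (allAssignments-sound n ⟦ p ⟧ᵇ valid (map (eval v) σ))

  taut-mp : ∀ {n} (σ : Vec Formula n) → Allᵛ.All WfF σ → (ps : List (Schema n)) (q : Schema n) →
            {valid : Valid (ps ⟹ q)} → All (λ p → ⊢ ⟦ p ⟧ σ) ps → ⊢ ⟦ q ⟧ σ
  taut-mp σ wσ ps q {valid} ds = discharge ps ds (tautology-instance wσ (ps ⟹ q) valid)
    where
    discharge : ∀ ps → All (λ p → ⊢ ⟦ p ⟧ σ) ps → ⊢ ⟦ ps ⟹ q ⟧ σ → ⊢ ⟦ q ⟧ σ
    discharge []       []       d = d
    discharge (p ∷ ps) (dp ∷ ds) d = discharge ps ds (mp dp d)

  by-taut : ∀ {n} (σ : Vec Formula n) (ps : List (Schema n)) (q : Schema n) →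
            {valid : Valid (ps ⟹ q)} {wσ : T (is-just (allWf? σ))} →
            All (λ p → ⊢ ⟦ p ⟧ σ) ps → ⊢ ⟦ q ⟧ σ
  by-taut σ ps q {valid} {wσ} = taut-mp σ (to-witness-T (allWf? σ) wσ) ps q {valid}

  ∧-intro : ∀ {φ ψ} → ⊢ φ → ⊢ ψ → ⊢ and φ ψ
  ∧-intro {φ} {ψ} dφ dψ =
    taut-mp (φ ∷ ψ ∷ []) (⊢-wf dφ ∷ ⊢-wf dψ ∷ []) (# 0 ∷ # 1 ∷ []) (# 0 ∧' # 1) (dφ ∷ dψ ∷ [])

  ¬∃-intro⇒ : ∀ {Γ φ} x → ⊢ Γ ⇒ neg φ → x ∉ FvF Γ → ⊢ Γ ⇒ neg (ex x φ)
  ¬∃-intro⇒ {Γ} {φ} x d x∉Γ =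
    taut-mp (Γ ∷ ex x φ ∷ []) (wΓ ∷ wf-ex wφ ∷ []) (# 1 ⇒' ¬' # 0 ∷ []) (# 0 ⇒' ¬' # 1)
      (∃-intro φ⇒¬Γ x∉Γ ∷ [])
    where
    wΓ : WfF Γ
    wΓ = proj₁ (wf-⇒⁻ (⊢-wf d))
    wφ : WfF φ
    wφ = wf-neg⁻ (proj₂ (wf-⇒⁻ (⊢-wf d)))
    φ⇒¬Γ : ⊢ φ ⇒ neg Γ
    φ⇒¬Γ = taut-mp (Γ ∷ φ ∷ []) (wΓ ∷ wφ ∷ []) (# 0 ⇒' ¬' # 1 ∷ []) (# 1 ⇒' ¬' # 0) (d ∷ [])

  -- The closed theorem HF = HF serves as the hypothesis that ∃-intro requires.
  ¬∃-intro : ∀ {φ} x → ⊢ neg φ → ⊢ neg (ex x φ)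
  ¬∃-intro {φ} x d = mp (refl-ax wf-HF) (¬∃-intro⇒ x weakened λ ())
    where
    weakened : ⊢ eq HF HF ⇒ neg φ
    weakened = taut-mp (eq HF HF ∷ φ ∷ []) (wf-eq wf-HF wf-HF ∷ wf-neg⁻ (⊢-wf d) ∷ [])
                 (¬' # 1 ∷ []) (# 0 ⇒' ¬' # 1) (d ∷ [])

  ∀-intro⇒ : ∀ {Γ φ} x → ⊢ Γ ⇒ φ → x ∉ FvF Γ → ⊢ Γ ⇒ all x φ
  ∀-intro⇒ {Γ} {φ} x d =
    ¬∃-intro⇒ x (taut-mp (Γ ∷ φ ∷ []) (wf-⇒⁻ (⊢-wf d) .proj₁ ∷ wf-⇒⁻ (⊢-wf d) .proj₂ ∷ [])
                   (# 0 ⇒' # 1 ∷ []) (# 0 ⇒' ¬' ¬' # 1) (d ∷ []))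

  ∀-intro : ∀ {φ} x → ⊢ φ → ⊢ all x φ
  ∀-intro {φ} x d = ¬∃-intro x (taut-mp (φ ∷ []) (⊢-wf d ∷ []) (# 0 ∷ []) (¬' ¬' # 0) (d ∷ []))

  ∀-elim : ∀ {x φ} t → ⊢ all x φ →
           {ff : True (freeForF? t x φ)} {wφ[t] : WfChecked (substF t x φ)} → ⊢ substF t x φ
  ∀-elim {x} {φ} t d {ff} {wφ[t]} =
    taut-mp (ex x (neg φ) ∷ substF t x φ ∷ []) (wE ∷ wS ∷ []) (¬' # 0 ∷ (¬' # 1 ⇒' # 0) ∷ []) (# 1)
      (d ∷ subst-ax (wf-or (wf-neg (wf-neg wS)) wE) (toWitness ff) ∷ [])
    where
    wE : WfF (ex x (neg φ))
    wE = wf-neg⁻ (⊢-wf d)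
    wS : WfF (substF t x φ)
    wS = wf! _ wφ[t]

  inst : ∀ {φ} x t → ⊢ φ →
         {ff : True (freeForF? t x φ)} {wφ[t] : WfChecked (substF t x φ)} → ⊢ substF t x φ
  inst x t d {ff} {wφ[t]} = ∀-elim t (∀-intro x d) {ff} {wφ[t]}

  ∃-witness : ∀ x φ t →
              {ff : True (freeForF? t x φ)} {w : WfChecked (substF t x φ ⇒ ex x φ)} →
              ⊢ substF t x φ ⇒ ex x φ
  ∃-witness x φ t {ff} {w} = subst-ax (wf! _ w) (toWitness ff)

  eq-subst : ∀ t s z φ →
             {fft : True (freeForF? t z φ)} {ffs : True (freeForF? s z φ)}
             {w : WfChecked (eq t s ⇒ (substF t z φ ⇒ substF s z φ))} →
             ⊢ eq t s ⇒ (substF t z φ ⇒ substF s z φ)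
  eq-subst t s z φ {fft} {ffs} {w} = eq-ax {z = z} {φ = φ} (wf! _ w) (toWitness fft) (toWitness ffs)

open DerivedRules RST-HF

axiom : ∀ {φ} → RST-HF φ → {w : WfChecked φ} → ⊢ φ
axiom a {w} = nonlogical (wf! _ w) a

comprehension! : ∀ x φ {w : WfChecked (all x (mem (var x) (abs x φ) ⇔̇ φ))} →
                 ⊢ all x (mem (var x) (abs x φ) ⇔̇ φ)
comprehension! x φ {w} = nonlogical (wf! _ w) (comprehension (abs-wf (wf! _ w)))
  where
  abs-wf : WfF (all x (mem (var x) (abs x φ) ⇔̇ φ)) → WfT (abs x φ)
  abs-wf (wf-neg (wf-ex (wf-neg (wf-and (wf-or (wf-neg (wf-mem _ wa)) _) _)))) = wa

v : Var → Term
v = var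

-- The bound variables 11, 12, 13 below avoid the variables 0–10 of the axioms and of the
-- derivations, so that all substitutions are capture-free.
_⊆̇_ : Term → Term → Formula
a ⊆̇ b = neg (ex 13 (and (mem (v 13) a) (neg (mem (v 13) b))))

coveredIn : Term → Term → Formula
coveredIn t u = ex 12 (and (mem (v 12) u) (t ⊆̇ v 12))

loopFree : Term → Formula
loopFree t = neg (ex 11 (and (mem (v 11) t) (coveredIn t (v 11))))

loopFreeHF : Term
loopFreeHF = abs 10 (and (mem (v 10) HF) (loopFree (v 10)))

-- a ∪ {b}, written with the bound variables of hf-step and of hf-least respectively
adjoin₃ adjoin₆ : Term → Term → Term
adjoin₃ a b = unionT 3 a (singT 2 b)
adjoin₆ a b = unionT 6 a (singT 5 b)

loopFreeHF-def : ⊢ all 10 (mem (v 10) loopFreeHF ⇔̇ and (mem (v 10) HF) (loopFree (v 10)))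
loopFreeHF-def = comprehension! 10 _

adjoin₁₂ : Term
adjoin₁₂ = adjoin₆ (v 1) (v 2)

adjoin₁₂-def : ⊢ all 6 (mem (v 6) adjoin₁₂ ⇔̇ or (mem (v 6) (v 1)) (mem (v 6) (singT 5 (v 2))))
adjoin₁₂-def = comprehension! 6 _

singleton₂-def : ⊢ all 5 (mem (v 5) (singT 5 (v 2)) ⇔̇ eq (v 5) (v 2))
singleton₂-def = comprehension! 5 _

∅₀≡∅₄ : ⊢ eq (emptyT 0) (emptyT 4)
∅₀≡∅₄ = mp (∀-intro 2 same-members) (inst 1 (emptyT 4) (inst 0 (emptyT 0) (axiom extensionality)))
  where
  same-members : ⊢ mem (v 2) (emptyT 0) ⇔̇ mem (v 2) (emptyT 4)
  same-members =
    by-taut (mem (v 2) (emptyT 0) ∷ mem (v 2) (emptyT 4) ∷ eq (v 2) (v 2) ∷ [])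
      (# 0 ⇔' ¬' # 2 ∷ # 1 ⇔' ¬' # 2 ∷ # 2 ∷ []) (# 0 ⇔' # 1)
      (∀-elim (v 2) (comprehension! 0 (neg (eq (v 0) (v 0))))
       ∷ ∀-elim (v 2) (comprehension! 4 (neg (eq (v 4) (v 4))))
       ∷ refl-ax (wf-var 2) ∷ [])

adjoin₃≡adjoin₆ : ⊢ eq (adjoin₃ (v 7) (v 8)) (adjoin₆ (v 7) (v 8))
adjoin₃≡adjoin₆ =
  mp (∀-intro 2 same-members)
     (inst 1 (adjoin₆ (v 7) (v 8)) (inst 0 (adjoin₃ (v 7) (v 8)) (axiom extensionality)))
  where
  same-members : ⊢ mem (v 2) (adjoin₃ (v 7) (v 8)) ⇔̇ mem (v 2) (adjoin₆ (v 7) (v 8))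
  same-members =
    by-taut (mem (v 2) (adjoin₃ (v 7) (v 8)) ∷ mem (v 2) (v 7) ∷ mem (v 2) (singT 2 (v 8))
             ∷ eq (v 2) (v 8) ∷ mem (v 2) (adjoin₆ (v 7) (v 8)) ∷ mem (v 2) (singT 5 (v 8)) ∷ [])
      (# 0 ⇔' # 1 ∨' # 2 ∷ # 2 ⇔' # 3 ∷ # 4 ⇔' # 1 ∨' # 5 ∷ # 5 ⇔' # 3 ∷ []) (# 0 ⇔' # 4)
      (∀-elim (v 2) (comprehension! 3 (or (mem (v 3) (v 7)) (mem (v 3) (singT 2 (v 8)))))
       ∷ ∀-elim (v 2) (comprehension! 2 (eq (v 2) (v 8)))
       ∷ ∀-elim (v 2) (comprehension! 6 (or (mem (v 6) (v 7)) (mem (v 6) (singT 5 (v 8)))))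
       ∷ ∀-elim (v 2) (comprehension! 5 (eq (v 5) (v 8))) ∷ [])

∅∈HF : ⊢ mem (emptyT 4) HF
∅∈HF = mp (axiom hf-empty) (mp ∅₀≡∅₄ (eq-subst (emptyT 0) (emptyT 4) 9 (mem (v 9) HF)))

-- hf-step is first instantiated at the fresh variables 7, 8: substituting v 1 for 0 directly
-- would be captured by the inner quantifier ∀1.
HF-adjoin : ⊢ mem (v 1) HF ⇒ (mem (v 2) HF ⇒ mem adjoin₁₂ HF)
HF-adjoin = inst 8 (v 2) (inst 7 (v 1) at78)
  where
  at78 : ⊢ mem (v 7) HF ⇒ (mem (v 8) HF ⇒ mem (adjoin₆ (v 7) (v 8)) HF)
  at78 =
    by-taut (mem (v 7) HF ∷ mem (v 8) HF ∷ mem (adjoin₃ (v 7) (v 8)) HF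
             ∷ mem (adjoin₆ (v 7) (v 8)) HF ∷ eq (adjoin₃ (v 7) (v 8)) (adjoin₆ (v 7) (v 8)) ∷ [])
      (# 0 ∧' # 1 ⇒' # 2 ∷ # 4 ∷ # 4 ⇒' (# 2 ⇒' # 3) ∷ []) (# 0 ⇒' (# 1 ⇒' # 3))
      (∀-elim (v 8) (∀-elim (v 7) (axiom hf-step))
       ∷ adjoin₃≡adjoin₆
       ∷ eq-subst (adjoin₃ (v 7) (v 8)) (adjoin₆ (v 7) (v 8)) 9 (mem (v 9) HF) ∷ [])

loopFree-∅ : ⊢ loopFree (emptyT 4)
loopFree-∅ =
  ¬∃-intro 11
    (by-taut (mem (v 11) (emptyT 4) ∷ eq (v 11) (v 11) ∷ coveredIn (emptyT 4) (v 11) ∷ [])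
       (# 0 ⇔' ¬' # 1 ∷ # 1 ∷ []) (¬' (# 0 ∧' # 2))
       (∀-elim (v 11) (comprehension! 4 (neg (eq (v 4) (v 4)))) ∷ refl-ax (wf-var 11) ∷ []))

∅∈loopFreeHF : ⊢ mem (emptyT 4) loopFreeHF
∅∈loopFreeHF =
  by-taut (mem (emptyT 4) loopFreeHF ∷ mem (emptyT 4) HF ∷ loopFree (emptyT 4) ∷ [])
    (# 0 ⇔' # 1 ∧' # 2 ∷ # 1 ∷ # 2 ∷ []) (# 0)
    (∀-elim (emptyT 4) loopFreeHF-def ∷ ∅∈HF ∷ loopFree-∅ ∷ [])

loopFree⇒∉ : ⊢ loopFree (v 0) ⇒ (mem (v 1) (v 0) ⇒ neg (mem (v 0) (v 1)))
loopFree⇒∉ =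
  by-taut (mem (v 1) (v 0) ∷ mem (v 0) (v 1) ∷ v 0 ⊆̇ v 0 ∷ coveredIn (v 0) (v 1) ∷ ex 11 loop ∷ [])
    (# 1 ∧' # 2 ⇒' # 3 ∷ # 0 ∧' # 3 ⇒' # 4 ∷ # 2 ∷ []) (¬' # 4 ⇒' # 0 ⇒' ¬' # 1)
    (∃-witness 12 cover (v 0) ∷ ∃-witness 11 loop (v 1) ∷ ⊆̇-refl ∷ [])
  where
  cover loop : Formula
  cover = and (mem (v 12) (v 1)) (v 0 ⊆̇ v 12)
  loop  = and (mem (v 11) (v 0)) (coveredIn (v 0) (v 11))
  ⊆̇-refl : ⊢ v 0 ⊆̇ v 0
  ⊆̇-refl = ¬∃-intro 13 (by-taut (mem (v 13) (v 0) ∷ []) [] (¬' (# 0 ∧' ¬' # 0)) [])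

v₂∈adjoin₁₂ : ⊢ mem (v 2) adjoin₁₂
v₂∈adjoin₁₂ =
  by-taut (mem (v 2) adjoin₁₂ ∷ mem (v 2) (v 1) ∷ mem (v 2) (singT 5 (v 2)) ∷ eq (v 2) (v 2) ∷ [])
    (# 0 ⇔' # 1 ∨' # 2 ∷ # 2 ⇔' # 3 ∷ # 3 ∷ []) (# 0)
    (∀-elim (v 2) adjoin₁₂-def ∷ ∀-elim (v 2) singleton₂-def ∷ refl-ax (wf-var 2) ∷ [])

escapes : Term → Formula
escapes a = and (mem (v 13) a) (neg (mem (v 13) (v 12)))

adjoin₁₂-⊆̇ : ⊢ adjoin₁₂ ⊆̇ v 12 ⇒ v 1 ⊆̇ v 12
adjoin₁₂-⊆̇ =
  by-taut (ex 13 (escapes (v 1)) ∷ ex 13 (escapes adjoin₁₂) ∷ []) (# 0 ⇒' ¬' ¬' # 1 ∷ []) (¬' # 1 ⇒' ¬' # 0)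
    (∃-intro escapes-v₁ (fresh 13) ∷ [])
  where
  escapes-v₁ : ⊢ escapes (v 1) ⇒ neg (adjoin₁₂ ⊆̇ v 12)
  escapes-v₁ =
    by-taut (mem (v 13) (v 1) ∷ mem (v 13) adjoin₁₂ ∷ mem (v 13) (singT 5 (v 2))
             ∷ mem (v 13) (v 12) ∷ ex 13 (escapes adjoin₁₂) ∷ [])
      (# 1 ⇔' # 0 ∨' # 2 ∷ # 1 ∧' ¬' # 3 ⇒' # 4 ∷ []) (# 0 ∧' ¬' # 3 ⇒' ¬' ¬' # 4)
      (∀-elim (v 13) adjoin₁₂-def ∷ ∃-witness 13 (escapes adjoin₁₂) (v 13) ∷ [])

loop-through-old : ⊢ mem (v 11) (v 1) ⇒ mem (v 12) (v 11) ⇒ adjoin₁₂ ⊆̇ v 12 ⇒ neg (loopFree (v 1))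
loop-through-old =
  by-taut (mem (v 11) (v 1) ∷ mem (v 12) (v 11) ∷ adjoin₁₂ ⊆̇ v 12 ∷ v 1 ⊆̇ v 12
           ∷ coveredIn (v 1) (v 11) ∷ ex 11 loop ∷ [])
    (# 2 ⇒' # 3 ∷ # 1 ∧' # 3 ⇒' # 4 ∷ # 0 ∧' # 4 ⇒' # 5 ∷ []) (# 0 ⇒' # 1 ⇒' # 2 ⇒' ¬' ¬' # 5)
    (adjoin₁₂-⊆̇ ∷ ∃-witness 12 cover (v 12) ∷ ∃-witness 11 loop (v 11) ∷ [])
  where
  cover loop : Formula
  cover = and (mem (v 12) (v 11)) (v 1 ⊆̇ v 12)
  loop  = and (mem (v 11) (v 1)) (coveredIn (v 1) (v 11))

loop-through-new : ⊢ eq (v 11) (v 2) ⇒ mem (v 12) (v 11) ⇒ adjoin₁₂ ⊆̇ v 12 ⇒ neg (loopFree (v 2))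
loop-through-new =
  by-taut (eq (v 11) (v 2) ∷ mem (v 12) (v 11) ∷ mem (v 12) (v 2) ∷ ex 13 (escapes adjoin₁₂)
           ∷ mem (v 2) adjoin₁₂ ∷ mem (v 2) (v 12) ∷ loopFree (v 2) ∷ [])
    (# 0 ⇒' # 1 ⇒' # 2 ∷ # 4 ∷ # 4 ∧' ¬' # 5 ⇒' # 3 ∷ # 6 ⇒' # 2 ⇒' ¬' # 5 ∷ [])
    (# 0 ⇒' # 1 ⇒' ¬' # 3 ⇒' ¬' # 6)
    (eq-subst (v 11) (v 2) 9 (mem (v 12) (v 9)) ∷ v₂∈adjoin₁₂ ∷ ∃-witness 13 (escapes adjoin₁₂) (v 2)
     ∷ inst 1 (v 12) (inst 0 (v 2) loopFree⇒∉) ∷ [])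

loopFree-adjoin₁₂ : ⊢ and (loopFree (v 1)) (loopFree (v 2)) ⇒ loopFree adjoin₁₂
loopFree-adjoin₁₂ = ¬∃-intro⇒ 11 no-loop-at-v₁₁ (fresh 11)
  where
  both : Formula
  both = and (loopFree (v 1)) (loopFree (v 2))
  cover⇒v₁₁∉ : ⊢ and (mem (v 12) (v 11)) (adjoin₁₂ ⊆̇ v 12) ⇒ both ⇒ neg (mem (v 11) adjoin₁₂)
  cover⇒v₁₁∉ =
    by-taut (mem (v 11) adjoin₁₂ ∷ mem (v 11) (v 1) ∷ mem (v 11) (singT 5 (v 2)) ∷ eq (v 11) (v 2)
             ∷ mem (v 12) (v 11) ∷ adjoin₁₂ ⊆̇ v 12 ∷ loopFree (v 1) ∷ loopFree (v 2) ∷ [])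
      (# 0 ⇔' # 1 ∨' # 2 ∷ # 2 ⇔' # 3 ∷ # 1 ⇒' # 4 ⇒' # 5 ⇒' ¬' # 6 ∷ # 3 ⇒' # 4 ⇒' # 5 ⇒' ¬' # 7 ∷ [])
      (# 4 ∧' # 5 ⇒' # 6 ∧' # 7 ⇒' ¬' # 0)
      (∀-elim (v 11) adjoin₁₂-def ∷ ∀-elim (v 11) singleton₂-def ∷ loop-through-old ∷ loop-through-new ∷ [])
  no-loop-at-v₁₁ : ⊢ both ⇒ neg (and (mem (v 11) adjoin₁₂) (coveredIn adjoin₁₂ (v 11)))
  no-loop-at-v₁₁ =
    by-taut (coveredIn adjoin₁₂ (v 11) ∷ both ∷ mem (v 11) adjoin₁₂ ∷ [])
      (# 0 ⇒' # 1 ⇒' ¬' # 2 ∷ []) (# 1 ⇒' ¬' (# 2 ∧' # 0))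
      (∃-intro cover⇒v₁₁∉ (fresh 12) ∷ [])

loopFreeHF-adjoin : ⊢ all 1 (mem (v 1) loopFreeHF ⇒ all 2 (mem (v 2) loopFreeHF ⇒ mem adjoin₁₂ loopFreeHF))
loopFreeHF-adjoin = ∀-intro 1 (∀-intro⇒ 2 closed (fresh 2))
  where
  closed : ⊢ mem (v 1) loopFreeHF ⇒ mem (v 2) loopFreeHF ⇒ mem adjoin₁₂ loopFreeHF
  closed =
    by-taut (mem (v 1) loopFreeHF ∷ mem (v 1) HF ∷ loopFree (v 1)
             ∷ mem (v 2) loopFreeHF ∷ mem (v 2) HF ∷ loopFree (v 2)
             ∷ mem adjoin₁₂ loopFreeHF ∷ mem adjoin₁₂ HF ∷ loopFree adjoin₁₂ ∷ [])
      (# 0 ⇔' # 1 ∧' # 2 ∷ # 3 ⇔' # 4 ∧' # 5 ∷ # 6 ⇔' # 7 ∧' # 8 ∷ # 1 ⇒' # 4 ⇒' # 7 ∷ # 2 ∧' # 5 ⇒' # 8 ∷ [])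
      (# 0 ⇒' # 3 ⇒' # 6)
      (∀-elim (v 1) loopFreeHF-def ∷ ∀-elim (v 2) loopFreeHF-def ∷ ∀-elim adjoin₁₂ loopFreeHF-def
       ∷ HF-adjoin ∷ loopFree-adjoin₁₂ ∷ [])

HF⊆loopFreeHF : ⊢ all 3 (mem (v 3) HF ⇒ mem (v 3) loopFreeHF)
HF⊆loopFreeHF = mp (∧-intro ∅∈loopFreeHF loopFreeHF-adjoin) (∀-elim loopFreeHF (axiom hf-least))

lemma4p1 : RST-HF ⊢ hf-no-2-cycles
lemma4p1 = ∀-intro 0 (∀-intro⇒ 1 no-2-cycle (fresh 1))
  where
  no-2-cycle : ⊢ mem (v 0) HF ⇒ mem (v 1) (v 0) ⇒ neg (mem (v 0) (v 1))
  no-2-cycle =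
    by-taut (mem (v 0) HF ∷ mem (v 0) loopFreeHF ∷ loopFree (v 0) ∷ mem (v 1) (v 0) ∷ mem (v 0) (v 1) ∷ [])
      (# 0 ⇒' # 1 ∷ # 1 ⇔' # 0 ∧' # 2 ∷ # 2 ⇒' # 3 ⇒' ¬' # 4 ∷ [])
      (# 0 ⇒' # 3 ⇒' ¬' # 4)
      (∀-elim (v 0) HF⊆loopFreeHF ∷ ∀-elim (v 0) loopFreeHF-def ∷ loopFree⇒∉ ∷ [])
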